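{- Let $c,d$ be unlabeled configurations on $\mathbb{Z}$ with the same number of chips, and suppose $c\lessdot d$, i.e., $d$ is obtained from $c$ by moving one chip rightward by one vertex. Then $\widetilde{c}\lessdot\widetilde{d}$, i.e., $\widetilde{d}$ is obtained from $\widetilde{c}$ by moving one chip rightward by one vertex.
   Context: Unlabeled chip-firing on $\mathbb{Z}$: a configuration is a function $c\colon\mathbb{Z}\to\mathbb{N}$ with finite total sum; if $c(i)\geq2$ one may fire at $i$, moving one chip from $i$ to $i-1$ and one to $i+1$. $c$ is stable if $c(i)\leq1$ for all $i$; every $c$ has a unique stable $\widetilde{c}$ reachable from $c$ by firings. Partial order on configurations of $n$ chips: $c\leq d$ iff $\sum_{i\leq j}c(i)\leq\sum_{i\leq j}d(i)$ for all $j$; $c\lessdot d$ denotes a cover relation, equivalently $c=c'+\delta_i$ and $d=c'+\delta_{i+1}$ for some configuration $c'$ and $i\in\mathbb{Z}$ (where $\delta_i$ is a single chip at $i$). -}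

module Defs where

open import Data.Nat using (ℕ; zero; suc; _+_; _*_; _≤_; _<_)
open import Data.Integer as ℤ using (ℤ; ∣_∣)
open import Data.Product using (∃; _×_; Σ)
open import Relation.Binary.PropositionalEquality using (_≡_)
open import Relation.Nullary using (yes; no)
open import Relation.Binary.Construct.Closure.ReflexiveTransitive using (Star)

-- An (unlabeled) configuration on ℤ: number of chips at each vertex.
Config : Set
Config = ℤ → ℕ

-- finite total sum = finite support
Finite : Config → Set
Finite c = ∃ λ (N : ℕ) → ∀ (i : ℤ) → N < ∣ i ∣ → c i ≡ 0

δ : ℤ → Config
δ i j with i ℤ.≟ j
... | yes _ = 1
... | no  _ = 0

_⊕_ : Config → Config → Config
(c ⊕ d) j = c j + d j

_≗ᶜ_ : Config → Config → Set
c ≗ᶜ d = ∀ j → c j ≡ d j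

-- one firing at vertex i turns c into d: c i ≥ 2, and one chip from i
-- moves to i-1, one to i+1:  d + 2δᵢ = c + δ_{i-1} + δ_{i+1}
Fire : ℤ → Config → Config → Set
Fire i c d = (2 ≤ c i) × (∀ j → d j + 2 * δ i j ≡ c j + δ (i ℤ.- ℤ.+ 1) j + δ (i ℤ.+ ℤ.+ 1) j)

_⟶_ : Config → Config → Set
c ⟶ d = ∃ λ i → Fire i c d

_⟶*_ : Config → Config → Set
_⟶*_ = Star _⟶_

Stable : Config → Set
Stable c = ∀ i → c i ≤ 1

-- c̃ is "the" stabilization of c (unique by the paper's standing fact)
IsStabilization : Config → Config → Set
IsStabilization c c̃ = (c ⟶* c̃) × Stable c̃

_⋖_ : Config → Config → Set
c ⋖ d = Σ Config λ c' → Σ ℤ λ i →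
          (c ≗ᶜ (c' ⊕ δ i)) × (d ≗ᶜ (c' ⊕ δ (i ℤ.+ ℤ.+ 1)))

-- Track the moved chip through the two stabilizations. Replay the firings of
-- c; when c fires at v, let d fire at v as well if it can: a legal firing can
-- be inserted into any stabilizing sequence without changing its stable end
-- (an exchange argument), and firing the same vertex in both keeps the cover.
-- If d cannot fire at v, then v is the source j of the moved chip, and firing
-- j in c turns the cover at j into a cover at j − 1. Once c is stable, d can
-- only fire at the target j + 1, which turns the cover into one at j + 1.
module Submission where

open import Defs
open import Data.Nat using (_+_; _*_; _∸_; _≤_; _<_; z≤n; _≤?_)
open import Data.Nat.Properties
open import Data.Integer as ℤ using (ℤ)
import Data.Integer.Properties as ℤ
open import Data.Product using (∃; _,_)
open import Function using (_∘_)
open import Relation.Nullary using (yes; no; contradiction)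
open import Relation.Binary.PropositionalEquality
  using (_≡_; _≢_; refl; sym; trans; cong; subst; ≢-sym; module ≡-Reasoning)
import Relation.Binary.Construct.Closure.ReflexiveTransitive as Star
open import Algebra.Properties.CommutativeSemigroup +-commutativeSemigroup using (xy∙z≈xz∙y; x∙yz≈xz∙y)
open import Data.Nat.Tactic.RingSolver using (solve-∀)
import Data.Integer.Tactic.RingSolver as ℤ-Solver

variable
  x x′ x₁ y y′ y₁ z s t r a r′ a′ b : Config
  i j v w : ℤ

[i+1]-1≡i : ∀ i → i ℤ.+ ℤ.+ 1 ℤ.- ℤ.+ 1 ≡ i
[i+1]-1≡i = ℤ-Solver.solve-∀

[i-1]+1≡i : ∀ i → i ℤ.- ℤ.+ 1 ℤ.+ ℤ.+ 1 ≡ i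
[i-1]+1≡i = ℤ-Solver.solve-∀

i≢i+1 : ∀ i → i ≢ i ℤ.+ ℤ.+ 1
i≢i+1 i i≡i+1 = ℤ.i≢suc[i] (trans i≡i+1 (ℤ.+-comm i (ℤ.+ 1)))

δ-diag : ∀ i → δ i i ≡ 1
δ-diag i with i ℤ.≟ i
... | yes _ = refl
... | no i≢i = contradiction refl i≢i

δ-≢ : i ≢ j → δ i j ≡ 0
δ-≢ {i} {j} i≢j with i ℤ.≟ j
... | yes i≡j = contradiction i≡j i≢j
... | no _ = refl

δ-pos : 0 < δ i j → i ≡ j
δ-pos {i} {j} with i ℤ.≟ j
... | yes i≡j = λ _ → i≡j
... | no _ = λ ()

-- y = x − r + a, stated without subtraction. A record rather than a function
-- type so that the four configurations can be inferred from it.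
record _≗_−_+_ (y x r a : Config) : Set where
  constructor shift
  field at : ∀ k → y k + r k ≡ x k + a k

open _≗_−_+_

infix 4 _≗_−_+_

shift-sym : y ≗ x − r + a → x ≗ y − a + r
shift-sym y≗ = shift λ k → sym (y≗ .at k)

shift-trans : y ≗ x − r + a → z ≗ y − s + b → z ≗ x − (r ⊕ s) + (a ⊕ b)
shift-trans {y} {x} {r} {a} {z} {s} {b} y≗ z≗ = shift λ k → begin
  z k + (r k + s k) ≡⟨ x∙yz≈xz∙y (z k) (r k) (s k) ⟩
  z k + s k + r k   ≡⟨ cong (_+ r k) (z≗ .at k) ⟩
  y k + b k + r k   ≡⟨ xy∙z≈xz∙y (y k) (b k) (r k) ⟩
  y k + r k + b k   ≡⟨ cong (_+ b k) (y≗ .at k) ⟩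
  x k + a k + b k   ≡⟨ +-assoc (x k) (a k) (b k) ⟩
  x k + (a k + b k) ∎
  where open ≡-Reasoning

shift-resp : (∀ k → r k + a′ k ≡ r′ k + a k) → y ≗ x − r + a → y ≗ x − r′ + a′
shift-resp {r} {a′} {r′} {a} {y} {x} same-net y≗ = shift λ k →
  +-cancelʳ-≡ (r k) (y k + r′ k) (x k + a′ k) (begin
    y k + r′ k + r k   ≡⟨ xy∙z≈xz∙y (y k) (r′ k) (r k) ⟩
    y k + r k + r′ k   ≡⟨ cong (_+ r′ k) (y≗ .at k) ⟩
    x k + a k + r′ k   ≡⟨ +-assoc (x k) (a k) (r′ k) ⟩
    x k + (a k + r′ k) ≡⟨ cong (x k +_) (trans (+-comm (a k) (r′ k)) (sym (same-net k))) ⟩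
    x k + (r k + a′ k) ≡⟨ x∙yz≈xz∙y (x k) (r k) (a′ k) ⟩
    x k + a′ k + r k   ∎)
  where open ≡-Reasoning

shift-functional : y ≗ x − r + a → y′ ≗ x − r + a → y ≗ᶜ y′
shift-functional {y} {x} {r} {a} {y′} y≗ y′≗ k =
  +-cancelʳ-≡ (r k) (y k) (y′ k) (trans (y≗ .at k) (sym (y′≗ .at k)))

shift-resp-≗ᶜ : x ≗ᶜ s → y ≗ᶜ t → y ≗ x − r + a → t ≗ s − r + a
shift-resp-≗ᶜ {x} {s} {y} {t} {r} {a} x≗s y≗t y≗ = shift λ k →
  trans (cong (_+ r k) (sym (y≗t k))) (trans (y≗ .at k) (cong (_+ a k) (x≗s k)))

shift-along : x₁ ≗ x − r + a → y₁ ≗ y − r + a → y ≗ x − s + b → y₁ ≗ x₁ − s + b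
shift-along {r = r} {a} {s = s} {b} x₁≗ y₁≗ y≗ =
  shift-resp (λ k → rearrange (r k) (a k) (s k) (b k))
    (shift-trans (shift-trans (shift-sym x₁≗) y≗) y₁≗)
  where
  rearrange : ∀ r a s b → a + s + r + b ≡ s + (r + b + a)
  rearrange = solve-∀

shift-mono : y ≗ x − r + a → r v ≡ 0 → x v ≤ y v
shift-mono {y} {x} {r} {a} {v} y≗ rv≡0 = begin
  x v       ≤⟨ m≤m+n (x v) (a v) ⟩
  x v + a v ≡⟨ sym (y≗ .at v) ⟩
  y v + r v ≡⟨ cong (y v +_) rv≡0 ⟩
  y v + 0   ≡⟨ +-identityʳ (y v) ⟩
  y v       ∎
  where open ≤-Reasoning

shift-removable : y ≗ x − r + a → a v ≡ 0 → r v ≤ x v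
shift-removable {y} {x} {r} {a} {v} y≗ av≡0 = begin
  r v       ≤⟨ m≤n+m (r v) (y v) ⟩
  y v + r v ≡⟨ y≗ .at v ⟩
  x v + a v ≡⟨ cong (x v +_) av≡0 ⟩
  x v + 0   ≡⟨ +-identityʳ (x v) ⟩
  x v       ∎
  where open ≤-Reasoning

shift-unstable-gains : y ≗ x − r + a → 2 ≤ y v → x v ≤ 1 → 0 < a v
shift-unstable-gains y≗ 2≤yv xv≤1 = n≢0⇒n>0 λ av≡0 →
  ≤⇒≯ xv≤1 (≤-trans 2≤yv (shift-mono (shift-sym y≗) av≡0))

loss gain : ℤ → Config
loss v k = 2 * δ v k
gain v = δ (v ℤ.- ℤ.+ 1) ⊕ δ (v ℤ.+ ℤ.+ 1)

record _⟶[_]_ (x : Config) (v : ℤ) (y : Config) : Set where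
  constructor firing
  field
    legal   : 2 ≤ x v
    shifted : y ≗ x − loss v + gain v

open _⟶[_]_

Fire⇒⟶[] : Fire v x y → x ⟶[ v ] y
Fire⇒⟶[] {x = x} (legal , eq) = firing legal (shift λ k → trans (eq k) (+-assoc (x k) _ _))

fire : (v : ℤ) → 2 ≤ x v → ∃ (x ⟶[ v ]_)
fire {x} v legal = (λ k → x k + gain v k ∸ loss v k) , firing legal (shift λ k → m∸n+n≡m (loss≤ k))
  where
  loss≤ : ∀ k → loss v k ≤ x k + gain v k
  loss≤ k with v ℤ.≟ k
  ... | yes refl = ≤-trans legal (m≤m+n (x v) (gain v v))
  ... | no _ = z≤n

⟶[]-respˡ : x′ ≗ᶜ x → x ⟶[ v ] y → x′ ⟶[ v ] y
⟶[]-respˡ {v = v} x′≗x (firing legal y≗) =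
  firing (subst (2 ≤_) (sym (x′≗x v)) legal) (shift-resp-≗ᶜ (sym ∘ x′≗x) (λ _ → refl) y≗)

⟶[]-mono : x ⟶[ w ] y → w ≢ v → x v ≤ y v
⟶[]-mono f w≢v = shift-mono (f .shifted) (cong (2 *_) (δ-≢ w≢v))

-- Firing determines its result only pointwise, so a sequence is allowed to
-- end at any configuration pointwise equal to the target.
data _⇝_ : Config → Config → Set where
  stop : x ≗ᶜ s → x ⇝ s
  _◅_ : x ⟶[ v ] y → y ⇝ s → x ⇝ s

⟶*⇒⇝ : x ⟶* s → x ⇝ s
⟶*⇒⇝ Star.ε = stop λ _ → refl
⟶*⇒⇝ ((_ , f) Star.◅ steps) = Fire⇒⟶[] f ◅ ⟶*⇒⇝ steps

⇝-respˡ : x′ ≗ᶜ x → x ⇝ s → x′ ⇝ s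
⇝-respˡ x′≗x (stop x≗s) = stop λ k → trans (x′≗x k) (x≗s k)
⇝-respˡ x′≗x (f ◅ σ) = ⟶[]-respˡ x′≗x f ◅ σ

-- A legal firing can be inserted into a sequence reaching a stable
-- configuration: the sequence must fire the same vertex at some point, and
-- firings at distinct vertices commute.
⇝-fire : Stable s → x ⇝ s → x ⟶[ v ] x′ → x′ ⇝ s
⇝-fire {v = v} s-stable (stop x≗s) g =
  contradiction (subst (2 ≤_) (x≗s v) (g .legal)) (≤⇒≯ (s-stable v))
⇝-fire {v = v} s-stable (_◅_ {v = w} f σ) g with w ℤ.≟ v
... | yes refl = ⇝-respˡ (shift-functional (g .shifted) (f .shifted)) σ
... | no w≢v with fire v (≤-trans (g .legal) (⟶[]-mono f w≢v))
                | fire w (≤-trans (f .legal) (⟶[]-mono g (≢-sym w≢v)))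
... | x₁′ , g′ | x′₁ , f′ = f′ ◅ ⇝-respˡ commute (⇝-fire s-stable σ g′)
  where
  commute : x′₁ ≗ᶜ x₁′
  commute = shift-functional (shift-along (f .shifted) (f′ .shifted) (g .shifted)) (g′ .shifted)

_⋖⟨_⟩_ : Config → ℤ → Config → Set
x ⋖⟨ j ⟩ y = y ≗ x − δ j + δ (j ℤ.+ ℤ.+ 1)

⋖⇒⋖⟨⟩ : x ⋖ y → ∃ λ j → x ⋖⟨ j ⟩ y
⋖⇒⋖⟨⟩ {x} {y} (x′ , j , x≗ , y≗) = j , shift λ k → begin
  y k + δ j k                            ≡⟨ cong (_+ δ j k) (y≗ k) ⟩
  x′ k + δ (j ℤ.+ ℤ.+ 1) k + δ j k       ≡⟨ xy∙z≈xz∙y (x′ k) _ (δ j k) ⟩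
  x′ k + δ j k + δ (j ℤ.+ ℤ.+ 1) k       ≡⟨ cong (_+ δ (j ℤ.+ ℤ.+ 1) k) (sym (x≗ k)) ⟩
  x k + δ (j ℤ.+ ℤ.+ 1) k                ∎
  where open ≡-Reasoning

⋖⟨⟩⇒⋖ : x ⋖⟨ j ⟩ y → x ⋖ y
⋖⟨⟩⇒⋖ {x} {j} {y} x⋖y = (λ k → x k ∸ δ j k) , j , (λ k → sym (m∸n+n≡m (δ≤ k))) , λ k →
  +-cancelʳ-≡ (δ j k) (y k) _ (begin
    y k + δ j k                                ≡⟨ x⋖y .at k ⟩
    x k + δ (j ℤ.+ ℤ.+ 1) k                    ≡⟨ cong (_+ δ (j ℤ.+ ℤ.+ 1) k) (sym (m∸n+n≡m (δ≤ k))) ⟩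
    x k ∸ δ j k + δ j k + δ (j ℤ.+ ℤ.+ 1) k    ≡⟨ xy∙z≈xz∙y (x k ∸ δ j k) (δ j k) _ ⟩
    x k ∸ δ j k + δ (j ℤ.+ ℤ.+ 1) k + δ j k    ∎)
  where
  open ≡-Reasoning
  δ≤ : ∀ k → δ j k ≤ x k
  δ≤ k with j ℤ.≟ k
  ... | yes refl = subst (_≤ x j) (δ-diag j) (shift-removable x⋖y (δ-≢ (≢-sym (i≢i+1 j))))
  ... | no _ = z≤n

⋖⟨⟩-fire-both : x ⋖⟨ j ⟩ y → x ⟶[ v ] x₁ → y ⟶[ v ] y₁ → x₁ ⋖⟨ j ⟩ y₁
⋖⟨⟩-fire-both x⋖y f g = shift-along (f .shifted) (g .shifted) x⋖y

-- Where x is stable, y can only fire at the target of the moved chip.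
⋖⟨⟩-fire-target : x ⋖⟨ j ⟩ y → x v ≤ 1 → y ⟶[ v ] y₁ → x ⋖⟨ j ℤ.+ ℤ.+ 1 ⟩ y₁
⋖⟨⟩-fire-target {j = j} x⋖y xv≤1 g with δ-pos (shift-unstable-gains x⋖y (g .legal) xv≤1)
... | refl = shift-resp same-net (shift-trans x⋖y (g .shifted))
  where
  rearrange : ∀ m u p → m + 2 * u + p ≡ u + (u + (m + p))
  rearrange = solve-∀
  same-net : ∀ k → δ j k + loss (j ℤ.+ ℤ.+ 1) k + δ (j ℤ.+ ℤ.+ 1 ℤ.+ ℤ.+ 1) k
                 ≡ δ (j ℤ.+ ℤ.+ 1) k + (δ (j ℤ.+ ℤ.+ 1) k + gain (j ℤ.+ ℤ.+ 1) k)
  same-net k rewrite [i+1]-1≡i j = rearrange (δ j k) (δ (j ℤ.+ ℤ.+ 1) k) _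

-- Where y is stable, x can only fire at the source of the moved chip.
⋖⟨⟩-fire-source : x ⋖⟨ j ⟩ y → y v ≤ 1 → x ⟶[ v ] x₁ → x₁ ⋖⟨ j ℤ.- ℤ.+ 1 ⟩ y
⋖⟨⟩-fire-source {j = j} x⋖y yv≤1 f with δ-pos (shift-unstable-gains (shift-sym x⋖y) (f .legal) yv≤1)
... | refl = shift-resp same-net (shift-trans (shift-sym (f .shifted)) x⋖y)
  where
  rearrange : ∀ m u p → m + p + u + u ≡ m + (2 * u + p)
  rearrange = solve-∀
  same-net : ∀ k → gain j k + δ j k + δ (j ℤ.- ℤ.+ 1 ℤ.+ ℤ.+ 1) k
                 ≡ δ (j ℤ.- ℤ.+ 1) k + (loss j k + δ (j ℤ.+ ℤ.+ 1) k)
  same-net k rewrite [i-1]+1≡i j = rearrange (δ (j ℤ.- ℤ.+ 1) k) (δ j k) _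

-- Recursion on the first sequence, then on the second: ⇝-fire may lengthen
-- the second one while the first shrinks.
⋖⟨⟩-stabilize : Stable s → Stable t → x ⇝ s → y ⇝ t → x ⋖⟨ j ⟩ y → ∃ λ i → s ⋖⟨ i ⟩ t
⋖⟨⟩-stabilize _ _ (stop x≗s) (stop y≗t) x⋖y = _ , shift-resp-≗ᶜ x≗s y≗t x⋖y
⋖⟨⟩-stabilize s-stable t-stable (stop x≗s) (_◅_ {v = v} g τ) x⋖y =
  ⋖⟨⟩-stabilize s-stable t-stable (stop x≗s) τ
    (⋖⟨⟩-fire-target x⋖y (subst (_≤ 1) (sym (x≗s v)) (s-stable v)) g)
⋖⟨⟩-stabilize {y = y} s-stable t-stable (_◅_ {v = v} f σ) τ x⋖y with y v ≤? 1
... | yes yv≤1 = ⋖⟨⟩-stabilize s-stable t-stable σ τ (⋖⟨⟩-fire-source x⋖y yv≤1 f)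
... | no yv≰1 with fire v (≰⇒> yv≰1)
... | _ , g = ⋖⟨⟩-stabilize s-stable t-stable σ (⇝-fire t-stable τ g) (⋖⟨⟩-fire-both x⋖y f g)

lemma2p10 : (c d c̃ d̃ : Config) → Finite c → Finite d → c ⋖ d →
    IsStabilization c c̃ → IsStabilization d d̃ → c̃ ⋖ d̃
lemma2p10 c d c̃ d̃ _ _ c⋖d (c⟶*c̃ , c̃-stable) (d⟶*d̃ , d̃-stable)
  with _ , c⋖⟨j⟩d ← ⋖⇒⋖⟨⟩ c⋖d
  with _ , c̃⋖⟨i⟩d̃ ← ⋖⟨⟩-stabilize c̃-stable d̃-stable (⟶*⇒⇝ c⟶*c̃) (⟶*⇒⇝ d⟶*d̃) c⋖⟨j⟩d
  = ⋖⟨⟩⇒⋖ c̃⋖⟨i⟩d̃
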